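{- Let $\mathcal{V}$ be a variety and $\overline{x}$ a finite set of variables. The following are equivalent: (1) $\mathbf{F}(\overline{x})$ is coherent. (2) For any $t_1,\dots,t_n\in\mathrm{Tm}(\overline{x})$ and $\overline{y}=\{y_1,\dots,y_n\}$ (disjoint from $\overline{x}$), the congruence $\mathrm{Cg}^{\mathbf{F}(\overline{x},\overline{y})}(\{\langle y_1,t_1\rangle,\dots,\langle y_n,t_n\rangle\})\cap F(\overline{y})^2$ of $\mathbf{F}(\overline{y})$ is finitely generated. (3) For any $t_1,\dots,t_n\in\mathrm{Tm}(\overline{x})$ and $\overline{y}=\{y_1,\dots,y_n\}$ (disjoint from $\overline{x}$), there exists a finite set of equations $\Pi(\overline{y})$ such that for every equation $\varepsilon(\overline{y})$: $\{y_1\approx t_1,\dots,y_n\approx t_n\}\models_{\mathcal{V}}\varepsilon$ iff $\Pi\models_{\mathcal{V}}\varepsilon$.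
   Context: All algebras are in a fixed language $\mathcal{L}$; assume $\overline{x}\neq\emptyset$ or $\mathcal{L}$ has a constant. For a set of equations $\Gamma\cup\{\varepsilon\}$ over variables $\overline{z}$, $\Gamma\models_{\mathcal{V}}\varepsilon$ means: for every $\mathbf{A}\in\mathcal{V}$ and homomorphism $e\colon\mathbf{Tm}(\overline{z})\to\mathbf{A}$, $\Gamma\subseteq\ker(e)$ implies $\varepsilon\in\ker(e)$. $\mathbf{F}(\overline{z})$ is the $\mathcal{V}$-free algebra over $\overline{z}$ (term algebra modulo $\{\langle s,t\rangle:\models_{\mathcal{V}}s\approx t\}$); terms are identified with their images in free algebras and $\mathbf{F}(\overline{y})$ is regarded as the subalgebra of $\mathbf{F}(\overline{x},\overline{y})$ generated by $\overline{y}$. $\mathrm{Cg}^{\mathbf{A}}(S)$ is the congruence generated by $S$; a congruence is finitely generated if it equals $\mathrm{Cg}^{\mathbf{A}}(S)$ for a finite $S$. An algebra in $\mathcal{V}$ is finitely presented if it is isomorphic to $\mathbf{F}(\overline{z})/\Theta$ for a finite $\overline{z}$ and a finitely generated congruence $\Theta$. A finitely presented algebra $\mathbf{A}\in\mathcal{V}$ is coherent if every finitely generated subalgebra of $\mathbf{A}$ is finitely presented. -}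

module Defs where

open import Level using (Level; _⊔_) renaming (suc to lsuc; zero to lzero)
open import Data.Nat using (ℕ; _>_)
open import Data.Fin using (Fin)
open import Data.Product using (Σ; Σ-syntax; ∃; ∃-syntax; _×_; _,_; proj₁; proj₂)
open import Data.Sum using (_⊎_; inj₁; inj₂)
open import Relation.Binary using (Rel; IsEquivalence)
open import Relation.Binary.PropositionalEquality using (_≡_)
open import Function using (_⇔_; _∘_)

record Language : Set₁ where
  field
    Op : Set
    ar : Op → ℕ

module _ (L : Language) where
  open Language L

  data Term (X : Set) : Set where
    var  : X → Term X
    node : (f : Op) → (Fin (ar f) → Term X) → Term X

  Equation : Set → Set
  Equation X = Term X × Term X

  rename : {X Y : Set} → (X → Y) → Term X → Term Y
  rename ρ (var x)     = var (ρ x)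
  rename ρ (node f ts) = node f (λ i → rename ρ (ts i))

  record Algebra (a ℓ : Level) : Set (lsuc (a ⊔ ℓ)) where
    field
      Carrier : Set a
      _≈_     : Rel Carrier ℓ
      isEquiv : IsEquivalence _≈_
      op      : (f : Op) → (Fin (ar f) → Carrier) → Carrier
      op-cong : (f : Op) {as bs : Fin (ar f) → Carrier} →
                (∀ i → as i ≈ bs i) → op f as ≈ op f bs

  ⟦_⟧ : ∀ {a ℓ} {A : Algebra a ℓ} {X : Set} →
        Term X → (X → Algebra.Carrier A) → Algebra.Carrier A
  ⟦_⟧ {A = A} (var x)     e = e x
  ⟦_⟧ {A = A} (node f ts) e = Algebra.op A f (λ i → ⟦_⟧ {A = A} (ts i) e)

  -- Varieties: equational classes Mod(E) for a set E of identities
  -- (identities are written over the countable set of variables ℕ)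

  record Variety : Set₁ where
    field
      Index : Set
      ident : Index → Equation ℕ

  _∈V_ : ∀ {a ℓ} → Algebra a ℓ → Variety → Set (a ⊔ ℓ)
  A ∈V V = ∀ (j : Variety.Index V) (e : ℕ → Algebra.Carrier A) →
           Algebra._≈_ A (⟦_⟧ {A = A} (proj₁ (Variety.ident V j)) e)
                         (⟦_⟧ {A = A} (proj₂ (Variety.ident V j)) e)

  Consequence : (V : Variety) {X I : Set} → (I → Equation X) → Equation X → Set₁
  Consequence V {X} {I} Γ ε =
    ∀ (A : Algebra lzero lzero) → A ∈V V → (e : X → Algebra.Carrier A) →
      (∀ (i : I) → Algebra._≈_ A (⟦_⟧ {A = A} (proj₁ (Γ i)) e)
                                 (⟦_⟧ {A = A} (proj₂ (Γ i)) e)) →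
      Algebra._≈_ A (⟦_⟧ {A = A} (proj₁ ε) e) (⟦_⟧ {A = A} (proj₂ ε) e)

  data Empty : Set where

  noHyp : {X : Set} → Empty → Equation X
  noHyp ()

  Valid : (V : Variety) {X : Set} → Term X → Term X → Set₁
  Valid V s t = Consequence V noHyp (s , t)

  F : (V : Variety) (X : Set) → Algebra lzero (lsuc lzero)
  F V X = record
    { Carrier = Term X
    ; _≈_     = Valid V
    ; isEquiv = record
        { refl  = λ A _ e _ → IsEquivalence.refl (Algebra.isEquiv A)
        ; sym   = λ p A AV e h → IsEquivalence.sym (Algebra.isEquiv A) (p A AV e h)
        ; trans = λ p q A AV e h →
            IsEquivalence.trans (Algebra.isEquiv A) (p A AV e h) (q A AV e h)
        }
    ; op      = node
    ; op-cong = λ f ps A AV e h → Algebra.op-cong A f (λ i → ps i A AV e h)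
    }

  data Cg {a ℓ r : Level} (A : Algebra a ℓ)
          (S : Rel (Algebra.Carrier A) r)
          : Rel (Algebra.Carrier A) (a ⊔ ℓ ⊔ r) where
    cg-gen   : ∀ {x y} → S x y → Cg A S x y
    cg-eq    : ∀ {x y} → Algebra._≈_ A x y → Cg A S x y
    cg-sym   : ∀ {x y} → Cg A S x y → Cg A S y x
    cg-trans : ∀ {x y z} → Cg A S x y → Cg A S y z → Cg A S x z
    cg-op    : (f : Op) {as bs : Fin (ar f) → Algebra.Carrier A} →
               (∀ i → Cg A S (as i) (bs i)) →
               Cg A S (Algebra.op A f as) (Algebra.op A f bs)

  PairsRel : ∀ {c} {C : Set c} {m : ℕ} → (Fin m → C × C) → Rel C c
  PairsRel {m = m} S x y = Σ[ i ∈ Fin m ] (proj₁ (S i) ≡ x × proj₂ (S i) ≡ y)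

  CgFin : ∀ {a ℓ} (A : Algebra a ℓ) {m : ℕ} →
          (Fin m → Algebra.Carrier A × Algebra.Carrier A) →
          Rel (Algebra.Carrier A) (a ⊔ ℓ)
  CgFin A S = Cg A (PairsRel S)

  Quot : ∀ {a ℓ} (A : Algebra a ℓ) {m : ℕ} →
         (Fin m → Algebra.Carrier A × Algebra.Carrier A) → Algebra a (a ⊔ ℓ)
  Quot A S = record
    { Carrier = Algebra.Carrier A
    ; _≈_     = CgFin A S
    ; isEquiv = record
        { refl  = cg-eq (IsEquivalence.refl (Algebra.isEquiv A))
        ; sym   = cg-sym
        ; trans = cg-trans
        }
    ; op      = Algebra.op A
    ; op-cong = cg-op
    }

  record IsHom {a ℓ b m} (A : Algebra a ℓ) (B : Algebra b m)
               (h : Algebra.Carrier A → Algebra.Carrier B) : Set (a ⊔ ℓ ⊔ m) where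
    field
      resp : ∀ {x y} → Algebra._≈_ A x y → Algebra._≈_ B (h x) (h y)
      hom  : (f : Op) (as : Fin (ar f) → Algebra.Carrier A) →
             Algebra._≈_ B (h (Algebra.op A f as)) (Algebra.op B f (h ∘ as))

  record _≅_ {a ℓ b m} (A : Algebra a ℓ) (B : Algebra b m) : Set (a ⊔ ℓ ⊔ b ⊔ m) where
    field
      to      : Algebra.Carrier A → Algebra.Carrier B
      from    : Algebra.Carrier B → Algebra.Carrier A
      to-hom  : IsHom A B to
      from-hom : IsHom B A from
      from∘to : ∀ x → Algebra._≈_ A (from (to x)) x
      to∘from : ∀ y → Algebra._≈_ B (to (from y)) y

  data InSg {a ℓ} (A : Algebra a ℓ) {m : ℕ} (gs : Fin m → Algebra.Carrier A)
            : Algebra.Carrier A → Set a where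
    sg-gen : (i : Fin m) → InSg A gs (gs i)
    sg-op  : (f : Op) {as : Fin (ar f) → Algebra.Carrier A} →
             (∀ i → InSg A gs (as i)) → InSg A gs (Algebra.op A f as)

  Sg : ∀ {a ℓ} (A : Algebra a ℓ) {m : ℕ} → (Fin m → Algebra.Carrier A) → Algebra a ℓ
  Sg A gs = record
    { Carrier = Σ (Algebra.Carrier A) (InSg A gs)
    ; _≈_     = λ x y → Algebra._≈_ A (proj₁ x) (proj₁ y)
    ; isEquiv = record
        { refl  = IsEquivalence.refl (Algebra.isEquiv A)
        ; sym   = IsEquivalence.sym (Algebra.isEquiv A)
        ; trans = IsEquivalence.trans (Algebra.isEquiv A)
        }
    ; op      = λ f as → Algebra.op A f (proj₁ ∘ as) , sg-op f (proj₂ ∘ as)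
    ; op-cong = λ f ps → Algebra.op-cong A f ps
    }

  FinitelyPresented : (V : Variety) → ∀ {a ℓ} → Algebra a ℓ → Set (lsuc lzero ⊔ a ⊔ ℓ)
  FinitelyPresented V B =
    Σ[ k ∈ ℕ ] Σ[ m ∈ ℕ ] Σ[ S ∈ (Fin m → Equation (Fin k)) ]
      (B ≅ Quot (F V (Fin k)) S)

  Coherent : (V : Variety) → ∀ {a ℓ} → Algebra a ℓ → Set (lsuc lzero ⊔ a ⊔ ℓ)
  Coherent V A =
    FinitelyPresented V A ×
    (∀ (m : ℕ) (gs : Fin m → Algebra.Carrier A) → FinitelyPresented V (Sg A gs))

  Cond1 : Variety → ℕ → Set₁
  Cond1 V k = Coherent V (F V (Fin k))

  embY : {k n : ℕ} → Term (Fin n) → Term (Fin k ⊎ Fin n)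
  embY = rename inj₂

  embX : {k n : ℕ} → Term (Fin k) → Term (Fin k ⊎ Fin n)
  embX = rename inj₁

  yt : {k n : ℕ} → (Fin n → Term (Fin k)) → Fin n → Equation (Fin k ⊎ Fin n)
  yt ts i = var (inj₂ i) , embX (ts i)

  Cond2 : Variety → ℕ → Set₁
  Cond2 V k =
    ∀ (n : ℕ) (ts : Fin n → Term (Fin k)) →
      Σ[ m ∈ ℕ ] Σ[ R ∈ (Fin m → Equation (Fin n)) ]
        (∀ (u v : Term (Fin n)) →
           CgFin (F V (Fin n)) R u v ⇔
           CgFin (F V (Fin k ⊎ Fin n)) (yt ts) (embY u) (embY v))

  Cond3 : Variety → ℕ → Set₁
  Cond3 V k =
    ∀ (n : ℕ) (ts : Fin n → Term (Fin k)) →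
      Σ[ m ∈ ℕ ] Σ[ Π ∈ (Fin m → Equation (Fin n)) ]
        (∀ (ε : Equation (Fin n)) →
           Consequence V (yt ts) (embY (proj₁ ε) , embY (proj₂ ε)) ⇔
           Consequence V Π ε)

  StandingAssumption : ℕ → Set
  StandingAssumption k = (k > 0) ⊎ (Σ[ c ∈ Language.Op L ] Language.ar L c ≡ 0)

-- All three conditions say that, for every tuple t̄ of terms over x̄, the kernel of the
-- substitution F(ȳ) → F(x̄), yᵢ ↦ tᵢ, is a finitely generated congruence.  For (2) and (3)
-- this follows from Birkhoff's completeness theorem together with the observation that
-- {ȳ ≈ t̄} ⊨ u(ȳ) ≈ v(ȳ) holds iff u(t̄) ≈ v(t̄) is valid.  For (1): the subalgebra of F(x̄)
-- generated by t̄ is F(ȳ) modulo that kernel, and conversely a finite presentation F(z̄)/Cg(S)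
-- of this subalgebra yields finitely many generators of the kernel by translating S, and the
-- generators z̄, into ȳ.
module Submission where

open import Defs
open import Data.Nat using (ℕ; _+_)
open import Data.Fin using (Fin; splitAt; _↑ˡ_; _↑ʳ_)
open import Data.Product using (Σ-syntax; _×_; _,_; proj₁; proj₂)
open import Data.Sum using (_⊎_; inj₁; inj₂; [_,_])
open import Data.Vec.Functional using (_++_)
open import Data.Vec.Functional.Properties using (lookup-++ˡ; lookup-++ʳ)
open import Function using (_⇔_; _∘_)
open import Function.Bundles using (mk⇔; Equivalence)
import Function.Properties.Equivalence as ⇔
open import Level using () renaming (zero to lzero; suc to lsuc)
open import Relation.Binary using (Setoid; IsEquivalence)
open import Relation.Binary.PropositionalEquality using (refl; cong)
import Relation.Binary.Reasoning.Setoid as SetoidReasoning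

module _ (L : Language) where

  PairsRel-++ˡ : ∀ {c} {C : Set c} {m n : ℕ} (S : Fin m → C × C) (T : Fin n → C × C) (i : Fin m) →
                 PairsRel L (S ++ T) (proj₁ (S i)) (proj₂ (S i))
  PairsRel-++ˡ {n = n} S T i = i ↑ˡ n , cong proj₁ (lookup-++ˡ S T i) , cong proj₂ (lookup-++ˡ S T i)

  PairsRel-++ʳ : ∀ {c} {C : Set c} {m n : ℕ} (S : Fin m → C × C) (T : Fin n → C × C) (i : Fin n) →
                 PairsRel L (S ++ T) (proj₁ (T i)) (proj₂ (T i))
  PairsRel-++ʳ {m = m} S T i = m ↑ʳ i , cong proj₁ (lookup-++ʳ S T i) , cong proj₂ (lookup-++ʳ S T i)

module _ {L : Language} where

  subst : {X Y : Set} → (Y → Term L X) → Term L Y → Term L X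
  subst σ (var y)     = σ y
  subst σ (node f ts) = node f (λ i → subst σ (ts i))

  module _ {a ℓ} (A : Algebra L a ℓ) where
    open Algebra A

    algebraSetoid : Setoid a ℓ
    algebraSetoid = record { Carrier = Carrier ; _≈_ = _≈_ ; isEquivalence = isEquiv }

    eval : {X : Set} → Term L X → (X → Carrier) → Carrier
    eval t e = ⟦_⟧ L {A = A} t e

    eval-cong : {X : Set} (t : Term L X) {e e′ : X → Carrier} →
                (∀ x → e x ≈ e′ x) → eval t e ≈ eval t e′
    eval-cong (var x)     e≈e′ = e≈e′ x
    eval-cong (node f ts) e≈e′ = op-cong f (λ i → eval-cong (ts i) e≈e′)

    eval-rename : {X Y : Set} (ρ : X → Y) (t : Term L X) (e : Y → Carrier) →
                  eval (rename L ρ t) e ≈ eval t (e ∘ ρ)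
    eval-rename ρ (var x)     e = IsEquivalence.refl isEquiv
    eval-rename ρ (node f ts) e = op-cong f (λ i → eval-rename ρ (ts i) e)

    eval-subst : {X Y : Set} (σ : Y → Term L X) (t : Term L Y) (e : X → Carrier) →
                 eval (subst σ t) e ≈ eval t (λ y → eval (σ y) e)
    eval-subst σ (var y)     e = IsEquivalence.refl isEquiv
    eval-subst σ (node f ts) e = op-cong f (λ i → eval-subst σ (ts i) e)

module _ {L : Language} (V : Variety L) where
  open Language L

  lhs rhs : Variety.Index V → Term L ℕ
  lhs j = proj₁ (Variety.ident V j)
  rhs j = proj₂ (Variety.ident V j)

  valid-refl : {X : Set} (s : Term L X) → Valid L V s s
  valid-refl s A _ _ _ = IsEquivalence.refl (Algebra.isEquiv A)

  infix 4 _⊢_≈_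

  data _⊢_≈_ {Z I : Set} (S : I → Equation L Z) : Term L Z → Term L Z → Set where
    ⊢-hyp   : (i : I) → S ⊢ proj₁ (S i) ≈ proj₂ (S i)
    ⊢-axiom : (j : Variety.Index V) (σ : ℕ → Term L Z) → S ⊢ subst σ (lhs j) ≈ subst σ (rhs j)
    ⊢-refl  : ∀ {s} → S ⊢ s ≈ s
    ⊢-sym   : ∀ {s t} → S ⊢ s ≈ t → S ⊢ t ≈ s
    ⊢-trans : ∀ {s t u} → S ⊢ s ≈ t → S ⊢ t ≈ u → S ⊢ s ≈ u
    ⊢-cong  : (f : Op) {ss ts : Fin (ar f) → Term L Z} →
              (∀ i → S ⊢ ss i ≈ ts i) → S ⊢ node f ss ≈ node f ts

  -- Unlike F(Z)/Cg(S), whose equality lives in Set₁, this is an algebra at the level over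
  -- which Consequence quantifies, so it can be used as the model in completeness.
  termAlgebra : {Z I : Set} → (I → Equation L Z) → Algebra L lzero lzero
  termAlgebra {Z} S = record
    { Carrier = Term L Z
    ; _≈_     = S ⊢_≈_
    ; isEquiv = record { refl = ⊢-refl ; sym = ⊢-sym ; trans = ⊢-trans }
    ; op      = node
    ; op-cong = ⊢-cong
    }

  module _ {Z I : Set} (S : I → Equation L Z) where

    eval-termAlgebra : {Y : Set} (t : Term L Y) (σ : Y → Term L Z) →
                       S ⊢ eval (termAlgebra S) t σ ≈ subst σ t
    eval-termAlgebra (var y)     σ = ⊢-refl
    eval-termAlgebra (node f ts) σ = ⊢-cong f (λ i → eval-termAlgebra (ts i) σ)

    eval-termAlgebra-var : (t : Term L Z) → S ⊢ eval (termAlgebra S) t var ≈ t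
    eval-termAlgebra-var (var z)     = ⊢-refl
    eval-termAlgebra-var (node f ts) = ⊢-cong f (λ i → eval-termAlgebra-var (ts i))

    termAlgebra∈V : _∈V_ L (termAlgebra S) V
    termAlgebra∈V j σ = ⊢-trans (eval-termAlgebra (lhs j) σ)
                          (⊢-trans (⊢-axiom j σ) (⊢-sym (eval-termAlgebra (rhs j) σ)))

    sound : ∀ {s t} → S ⊢ s ≈ t → Consequence L V S (s , t)
    sound (⊢-hyp i) A A∈V e hyps = hyps i
    sound (⊢-axiom j σ) A A∈V e hyps = begin
      eval A (subst σ (lhs j)) e             ≈⟨ eval-subst A σ (lhs j) e ⟩
      eval A (lhs j) (λ y → eval A (σ y) e) ≈⟨ A∈V j (λ y → eval A (σ y) e) ⟩
      eval A (rhs j) (λ y → eval A (σ y) e) ≈⟨ eval-subst A σ (rhs j) e ⟨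
      eval A (subst σ (rhs j)) e             ∎
      where open SetoidReasoning (algebraSetoid A)
    sound ⊢-refl A A∈V e hyps = IsEquivalence.refl (Algebra.isEquiv A)
    sound (⊢-sym d) A A∈V e hyps = IsEquivalence.sym (Algebra.isEquiv A) (sound d A A∈V e hyps)
    sound (⊢-trans d d′) A A∈V e hyps =
      IsEquivalence.trans (Algebra.isEquiv A) (sound d A A∈V e hyps) (sound d′ A A∈V e hyps)
    sound (⊢-cong f ds) A A∈V e hyps = Algebra.op-cong A f (λ i → sound (ds i) A A∈V e hyps)

    complete : ∀ {s t} → Consequence L V S (s , t) → S ⊢ s ≈ t
    complete {s} {t} s⊨t = begin
      s                               ≈⟨ eval-termAlgebra-var s ⟨
      eval (termAlgebra S) s var      ≈⟨ s⊨t (termAlgebra S) termAlgebra∈V var hyps-hold ⟩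
      eval (termAlgebra S) t var      ≈⟨ eval-termAlgebra-var t ⟩
      t                               ∎
      where
      open SetoidReasoning (algebraSetoid (termAlgebra S))
      hyps-hold : ∀ i → S ⊢ eval (termAlgebra S) (proj₁ (S i)) var ≈ eval (termAlgebra S) (proj₂ (S i)) var
      hyps-hold i = ⊢-trans (eval-termAlgebra-var (proj₁ (S i)))
                      (⊢-trans (⊢-hyp i) (⊢-sym (eval-termAlgebra-var (proj₂ (S i)))))

  module _ {Z : Set} {m : ℕ} (S : Fin m → Equation L Z) where

    Cg⇔⊢ : ∀ {s t} → CgFin L (F L V Z) S s t ⇔ S ⊢ s ≈ t
    Cg⇔⊢ = mk⇔ Cg⇒⊢ ⊢⇒Cg
      where
      Cg⇒⊢ : ∀ {s t} → CgFin L (F L V Z) S s t → S ⊢ s ≈ t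
      Cg⇒⊢ (cg-gen (i , refl , refl)) = ⊢-hyp i
      Cg⇒⊢ (cg-eq s≈t)      = complete S (λ A A∈V e _ → s≈t A A∈V e (λ ()))
      Cg⇒⊢ (cg-sym c)       = ⊢-sym (Cg⇒⊢ c)
      Cg⇒⊢ (cg-trans c c′)  = ⊢-trans (Cg⇒⊢ c) (Cg⇒⊢ c′)
      Cg⇒⊢ (cg-op f cs)     = ⊢-cong f (λ i → Cg⇒⊢ (cs i))

      ⊢⇒Cg : ∀ {s t} → S ⊢ s ≈ t → CgFin L (F L V Z) S s t
      ⊢⇒Cg (⊢-hyp i)       = cg-gen (i , refl , refl)
      ⊢⇒Cg (⊢-axiom j σ)   = cg-eq (sound (noHyp L) (⊢-axiom j σ))
      ⊢⇒Cg (⊢-refl {s})    = cg-eq (valid-refl s)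
      ⊢⇒Cg (⊢-sym d)       = cg-sym (⊢⇒Cg d)
      ⊢⇒Cg (⊢-trans d d′)  = cg-trans (⊢⇒Cg d) (⊢⇒Cg d′)
      ⊢⇒Cg (⊢-cong f ds)   = cg-op f (λ i → ⊢⇒Cg (ds i))

    ⊨⇔Cg : ∀ {s t} → Consequence L V S (s , t) ⇔ CgFin L (F L V Z) S s t
    ⊨⇔Cg = mk⇔ (Equivalence.from Cg⇔⊢ ∘ complete S) (sound S ∘ Equivalence.to Cg⇔⊢)

  infix 4 _≈ⱽ_

  -- Valid wrapped in a record, so that its two terms can be inferred from a proof of it.
  record _≈ⱽ_ {X : Set} (s t : Term L X) : Set₁ where
    constructor valid
    field holds : Valid L V s t
  open _≈ⱽ_

  ≈ⱽ-isEquivalence : {X : Set} → IsEquivalence (_≈ⱽ_ {X})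
  ≈ⱽ-isEquivalence = record
    { refl  = λ {s} → valid (valid-refl s)
    ; sym   = λ s≈t → valid (λ A A∈V e _ → IsEquivalence.sym (Algebra.isEquiv A) (holds s≈t A A∈V e (λ ())))
    ; trans = λ s≈t t≈u → valid (λ A A∈V e _ →
        IsEquivalence.trans (Algebra.isEquiv A) (holds s≈t A A∈V e (λ ())) (holds t≈u A A∈V e (λ ())))
    }

  ≈ⱽ-setoid : Set → Setoid lzero (lsuc lzero)
  ≈ⱽ-setoid X = record { Carrier = Term L X ; _≈_ = _≈ⱽ_ ; isEquivalence = ≈ⱽ-isEquivalence }

  open module ≈ⱽ {X : Set} = IsEquivalence (≈ⱽ-isEquivalence {X})
    using () renaming (refl to ≈ⱽ-refl; sym to ≈ⱽ-sym; trans to ≈ⱽ-trans)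

  ≈ⱽ-cong : {X : Set} (f : Op) {ss ts : Fin (ar f) → Term L X} →
            (∀ i → ss i ≈ⱽ ts i) → node f ss ≈ⱽ node f ts
  ≈ⱽ-cong {X} f {ss} {ts} ss≈ts = valid (Algebra.op-cong (F L V X) f {ss} {ts} (λ i → holds (ss≈ts i)))

  subst-resp-≈ⱽ : {X Y : Set} (σ : Y → Term L X) {s t : Term L Y} → s ≈ⱽ t → subst σ s ≈ⱽ subst σ t
  subst-resp-≈ⱽ σ {s} {t} s≈t = valid (λ A A∈V e _ → let open SetoidReasoning (algebraSetoid A) in
    begin
      eval A (subst σ s) e             ≈⟨ eval-subst A σ s e ⟩
      eval A s (λ y → eval A (σ y) e)  ≈⟨ holds s≈t A A∈V (λ y → eval A (σ y) e) (λ ()) ⟩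
      eval A t (λ y → eval A (σ y) e)  ≈⟨ eval-subst A σ t e ⟨
      eval A (subst σ t) e             ∎)

  subst-cong : {X Y : Set} {σ τ : Y → Term L X} → (∀ y → σ y ≈ⱽ τ y) → (s : Term L Y) →
               subst σ s ≈ⱽ subst τ s
  subst-cong σ≈τ (var y)     = σ≈τ y
  subst-cong σ≈τ (node f ss) = ≈ⱽ-cong f (λ i → subst-cong σ≈τ (ss i))

  subst-subst : {X Y W : Set} (σ : Y → Term L X) (τ : W → Term L Y) (s : Term L W) →
                subst σ (subst τ s) ≈ⱽ subst (subst σ ∘ τ) s
  subst-subst σ τ (var w)     = ≈ⱽ-refl
  subst-subst σ τ (node f ss) = ≈ⱽ-cong f (λ i → subst-subst σ τ (ss i))

  Cg∅⇒≈ⱽ : {X : Set} {s t : Term L X} → CgFin L (F L V X) {0} (λ ()) s t → s ≈ⱽ t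
  Cg∅⇒≈ⱽ c = valid (λ A A∈V e _ → sound (λ ()) (Equivalence.to (Cg⇔⊢ (λ ())) c) A A∈V e (λ ()))

  subst-resp-Cg : {X Y : Set} {m m′ : ℕ} {S : Fin m → Equation L Y} {T : Fin m′ → Equation L X}
                  (σ : Y → Term L X) →
                  (∀ l → CgFin L (F L V X) T (subst σ (proj₁ (S l))) (subst σ (proj₂ (S l)))) →
                  ∀ {u v} → CgFin L (F L V Y) S u v → CgFin L (F L V X) T (subst σ u) (subst σ v)
  subst-resp-Cg σ gens (cg-gen (l , refl , refl)) = gens l
  subst-resp-Cg σ gens {u} {v} (cg-eq u≈v) = cg-eq (holds (subst-resp-≈ⱽ σ {u} {v} (valid u≈v)))
  subst-resp-Cg σ gens (cg-sym c)      = cg-sym (subst-resp-Cg σ gens c)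
  subst-resp-Cg σ gens (cg-trans c c′) = cg-trans (subst-resp-Cg σ gens c) (subst-resp-Cg σ gens c′)
  subst-resp-Cg σ gens (cg-op f cs)    = cg-op f (λ i → subst-resp-Cg σ gens (cs i))

  Cg⊆kernel : {X Y : Set} {m : ℕ} {S : Fin m → Equation L Y} (σ : Y → Term L X) →
              (∀ l → subst σ (proj₁ (S l)) ≈ⱽ subst σ (proj₂ (S l))) →
              ∀ {u v} → CgFin L (F L V Y) S u v → subst σ u ≈ⱽ subst σ v
  Cg⊆kernel σ gens c = Cg∅⇒≈ⱽ (subst-resp-Cg σ (λ l → cg-eq (holds (gens l))) c)

  module _ {k n : ℕ} (ts : Fin n → Term L (Fin k)) where

    ⊨-yt⇔≈ⱽ-subst : (u v : Term L (Fin n)) →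
                    Consequence L V (yt L ts) (embY L u , embY L v) ⇔ subst ts u ≈ⱽ subst ts v
    ⊨-yt⇔≈ⱽ-subst u v = mk⇔ (λ yt⊨u≈v → valid (at-solution yt⊨u≈v)) (λ u≈v → at-any-model (holds u≈v))
      where
      at-solution : Consequence L V (yt L ts) (embY L u , embY L v) → Valid L V (subst ts u) (subst ts v)
      at-solution yt⊨u≈v A A∈V e _ = begin
        eval A (subst ts u) e  ≈⟨ eval-subst A ts u e ⟩
        eval A u (e′ ∘ inj₂)   ≈⟨ eval-rename A inj₂ u e′ ⟨
        eval A (embY L u) e′   ≈⟨ yt⊨u≈v A A∈V e′ e′-solves ⟩
        eval A (embY L v) e′   ≈⟨ eval-rename A inj₂ v e′ ⟩
        eval A v (e′ ∘ inj₂)   ≈⟨ eval-subst A ts v e ⟨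
        eval A (subst ts v) e  ∎
        where
        open Algebra A using (Carrier; _≈_)
        open Setoid (algebraSetoid A) using (sym)
        open SetoidReasoning (algebraSetoid A)
        e′ : Fin k ⊎ Fin n → Carrier
        e′ = [ e , (λ i → eval A (ts i) e) ]
        e′-solves : ∀ i → eval A (var (inj₂ i)) e′ ≈ eval A (embX L (ts i)) e′
        e′-solves i = sym (eval-rename A inj₁ (ts i) e′)

      at-any-model : Valid L V (subst ts u) (subst ts v) → Consequence L V (yt L ts) (embY L u , embY L v)
      at-any-model u≈v A A∈V e e-solves = begin
        eval A (embY L u) e            ≈⟨ embY-at-solution u ⟩
        eval A (subst ts u) (e ∘ inj₁) ≈⟨ u≈v A A∈V (e ∘ inj₁) (λ ()) ⟩
        eval A (subst ts v) (e ∘ inj₁) ≈⟨ embY-at-solution v ⟨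
        eval A (embY L v) e            ∎
        where
        open Algebra A using (_≈_)
        open Setoid (algebraSetoid A) using (trans)
        open SetoidReasoning (algebraSetoid A)
        embY-at-solution : (w : Term L (Fin n)) → eval A (embY L w) e ≈ eval A (subst ts w) (e ∘ inj₁)
        embY-at-solution w = begin
          eval A (embY L w) e                       ≈⟨ eval-rename A inj₂ w e ⟩
          eval A w (e ∘ inj₂)                       ≈⟨ eval-cong A w (λ i → trans (e-solves i) (eval-rename A inj₁ (ts i) e)) ⟩
          eval A w (λ i → eval A (ts i) (e ∘ inj₁)) ≈⟨ eval-subst A ts w (e ∘ inj₁) ⟨
          eval A (subst ts w) (e ∘ inj₁)            ∎

    Cg-yt⇔≈ⱽ-subst : (u v : Term L (Fin n)) →
                     CgFin L (F L V (Fin k ⊎ Fin n)) (yt L ts) (embY L u) (embY L v) ⇔ subst ts u ≈ⱽ subst ts v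
    Cg-yt⇔≈ⱽ-subst u v = ⇔.trans (⇔.sym (⊨⇔Cg (yt L ts))) (⊨-yt⇔≈ⱽ-subst u v)

  KernelFinitelyGenerated : {X : Set} {n : ℕ} → (Fin n → Term L X) → Set₁
  KernelFinitelyGenerated {n = n} ts =
    Σ[ m ∈ ℕ ] Σ[ R ∈ (Fin m → Equation L (Fin n)) ]
      (∀ u v → CgFin L (F L V (Fin n)) R u v ⇔ subst ts u ≈ⱽ subst ts v)

  module _ {X : Set} {n : ℕ} (ts : Fin n → Term L X) where

    generatingTerm : ∀ {a} → InSg L (F L V X) ts a → Term L (Fin n)
    generatingTerm (sg-gen i)    = var i
    generatingTerm (sg-op f a∈s) = node f (λ i → generatingTerm (a∈s i))

    subst-generatingTerm : ∀ {a} (a∈Sg : InSg L (F L V X) ts a) → subst ts (generatingTerm a∈Sg) ≈ⱽ a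
    subst-generatingTerm (sg-gen i)    = ≈ⱽ-refl
    subst-generatingTerm (sg-op f a∈s) = ≈ⱽ-cong f (λ i → subst-generatingTerm (a∈s i))

    subst∈Sg : (u : Term L (Fin n)) → InSg L (F L V X) ts (subst ts u)
    subst∈Sg (var i)     = sg-gen i
    subst∈Sg (node f us) = sg-op f (λ i → subst∈Sg (us i))

    kernelFG⇒Sg-finitelyPresented : KernelFinitelyGenerated ts → FinitelyPresented L V (Sg L (F L V X) ts)
    kernelFG⇒Sg-finitelyPresented (m , R , R⇔kernel) = n , m , R , record
      { to       = generatingTerm ∘ proj₂
      ; from     = λ u → subst ts u , subst∈Sg u
      ; to-hom   = record { resp = to-resp
                          ; hom  = λ f as → cg-eq (valid-refl (node f (generatingTerm ∘ proj₂ ∘ as))) }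
      ; from-hom = record { resp = holds ∘ Equivalence.to (R⇔kernel _ _)
                          ; hom  = λ f us → valid-refl (node f (subst ts ∘ us)) }
      ; from∘to  = holds ∘ subst-generatingTerm ∘ proj₂
      ; to∘from  = Equivalence.from (R⇔kernel _ _) ∘ subst-generatingTerm ∘ subst∈Sg
      }
      where
      to-resp : {a b : Algebra.Carrier (Sg L (F L V X) ts)} → Valid L V (proj₁ a) (proj₁ b) →
                CgFin L (F L V (Fin n)) R (generatingTerm (proj₂ a)) (generatingTerm (proj₂ b))
      to-resp {_ , a∈Sg} {_ , b∈Sg} a≈b = Equivalence.from (R⇔kernel _ _)
        (≈ⱽ-trans (subst-generatingTerm a∈Sg) (≈ⱽ-trans (valid a≈b) (≈ⱽ-sym (subst-generatingTerm b∈Sg))))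

    module _ {k′ m : ℕ} {S : Fin m → Equation L (Fin k′)}
             (iso : _≅_ L (Sg L (F L V X) ts) (Quot L (F L V (Fin k′)) S)) where
      open _≅_ iso
      private
        module toHom   = IsHom to-hom
        module fromHom = IsHom from-hom

      -- P and Q translate between the generators z̄ of the presentation and ȳ.  The kernel is
      -- generated by S translated into ȳ together with the equations yᵢ ≈ P(Q(yᵢ)).
      P : Fin k′ → Term L (Fin n)
      P j = generatingTerm (proj₂ (from (var j)))

      Q : Fin n → Term L (Fin k′)
      Q i = to (ts i , sg-gen i)

      S-in-ȳ : Fin m → Equation L (Fin n)
      S-in-ȳ l = subst P (proj₁ (S l)) , subst P (proj₂ (S l))

      ȳ≈PQȳ : Fin n → Equation L (Fin n)
      ȳ≈PQȳ i = var i , subst P (Q i)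

      R : Fin (m + n) → Equation L (Fin n)
      R = S-in-ȳ ++ ȳ≈PQȳ

      from≈subst : (s : Term L (Fin k′)) → proj₁ (from s) ≈ⱽ subst (proj₁ ∘ from ∘ var) s
      from≈subst (var j)     = ≈ⱽ-refl
      from≈subst (node f ss) = ≈ⱽ-trans (valid (fromHom.hom f ss)) (≈ⱽ-cong f (λ i → from≈subst (ss i)))

      subst-ts∘P : (s : Term L (Fin k′)) → subst ts (subst P s) ≈ⱽ proj₁ (from s)
      subst-ts∘P s = begin
        subst ts (subst P s)          ≈⟨ subst-subst ts P s ⟩
        subst (subst ts ∘ P) s        ≈⟨ subst-cong (λ j → subst-generatingTerm (proj₂ (from (var j)))) s ⟩
        subst (proj₁ ∘ from ∘ var) s  ≈⟨ from≈subst s ⟨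
        proj₁ (from s)                ∎
        where open SetoidReasoning (≈ⱽ-setoid X)

      R-in-kernel : ∀ r → subst ts (proj₁ (R r)) ≈ⱽ subst ts (proj₂ (R r))
      R-in-kernel r with splitAt m r
      ... | inj₁ l = begin
          subst ts (subst P (proj₁ (S l)))  ≈⟨ subst-ts∘P (proj₁ (S l)) ⟩
          proj₁ (from (proj₁ (S l)))        ≈⟨ valid (fromHom.resp (cg-gen (l , refl , refl))) ⟩
          proj₁ (from (proj₂ (S l)))        ≈⟨ subst-ts∘P (proj₂ (S l)) ⟨
          subst ts (subst P (proj₂ (S l)))  ∎
        where open SetoidReasoning (≈ⱽ-setoid X)
      ... | inj₂ i = begin
          ts i                              ≈⟨ valid (from∘to (ts i , sg-gen i)) ⟨
          proj₁ (from (Q i))                ≈⟨ subst-ts∘P (Q i) ⟨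
          subst ts (subst P (Q i))          ∎
        where open SetoidReasoning (≈ⱽ-setoid X)

      S⇒R : ∀ {s s′} → CgFin L (F L V (Fin k′)) S s s′ → CgFin L (F L V (Fin n)) R (subst P s) (subst P s′)
      S⇒R = subst-resp-Cg P (cg-gen ∘ PairsRel-++ˡ L S-in-ȳ ȳ≈PQȳ)

      ȳ≈P∘to : (u : Term L (Fin n)) → CgFin L (F L V (Fin n)) R u (subst P (to (subst ts u , subst∈Sg u)))
      ȳ≈P∘to (var i)     = cg-gen (PairsRel-++ʳ L S-in-ȳ ȳ≈PQȳ i)
      ȳ≈P∘to (node f us) = cg-trans (cg-op f (λ i → ȳ≈P∘to (us i)))
                             (cg-sym (S⇒R (toHom.hom f (λ i → subst ts (us i) , subst∈Sg (us i)))))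

      kernel⊆Cg : ∀ {u v} → subst ts u ≈ⱽ subst ts v → CgFin L (F L V (Fin n)) R u v
      kernel⊆Cg {u} {v} u≈v = cg-trans (ȳ≈P∘to u) (cg-trans (S⇒R to-u≈to-v) (cg-sym (ȳ≈P∘to v)))
        where to-u≈to-v = toHom.resp {subst ts u , subst∈Sg u} {subst ts v , subst∈Sg v} (holds u≈v)

      presentation⇒kernelFG : KernelFinitelyGenerated ts
      presentation⇒kernelFG = m + n , R , λ u v → mk⇔ (Cg⊆kernel ts R-in-kernel) kernel⊆Cg

    Sg-finitelyPresented⇒kernelFG : FinitelyPresented L V (Sg L (F L V X) ts) → KernelFinitelyGenerated ts
    Sg-finitelyPresented⇒kernelFG (_ , _ , _ , iso) = presentation⇒kernelFG iso

  module _ (k : ℕ) where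

    AllKernelsFinitelyGenerated : Set₁
    AllKernelsFinitelyGenerated = ∀ n (ts : Fin n → Term L (Fin k)) → KernelFinitelyGenerated ts

    F-finitelyPresented : FinitelyPresented L V (F L V (Fin k))
    F-finitelyPresented = k , 0 , (λ ()) , record
      { to       = λ s → s
      ; from     = λ s → s
      ; to-hom   = record { resp = cg-eq ; hom = λ f ss → cg-eq (valid-refl (node f ss)) }
      ; from-hom = record { resp = holds ∘ Cg∅⇒≈ⱽ ; hom = λ f ss → valid-refl (node f ss) }
      ; from∘to  = valid-refl
      ; to∘from  = cg-eq ∘ valid-refl
      }

    cond1⇔kernelsFG : Cond1 L V k ⇔ AllKernelsFinitelyGenerated
    cond1⇔kernelsFG = mk⇔
      (λ c1 n ts → Sg-finitelyPresented⇒kernelFG ts (proj₂ c1 n ts))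
      (λ fg → F-finitelyPresented , λ m gs → kernelFG⇒Sg-finitelyPresented gs (fg m gs))

    cond2⇔kernelsFG : Cond2 L V k ⇔ AllKernelsFinitelyGenerated
    cond2⇔kernelsFG = mk⇔
      (λ c2 n ts → retarget (Cg-yt⇔≈ⱽ-subst ts) (c2 n ts))
      (λ fg n ts → retarget (λ u v → ⇔.sym (Cg-yt⇔≈ⱽ-subst ts u v)) (fg n ts))
      where
      retarget : ∀ {n} {P Q : Term L (Fin n) → Term L (Fin n) → Set₁} → (∀ u v → P u v ⇔ Q u v) →
                 Σ[ m ∈ ℕ ] Σ[ R ∈ (Fin m → Equation L (Fin n)) ] (∀ u v → CgFin L (F L V (Fin n)) R u v ⇔ P u v) →
                 Σ[ m ∈ ℕ ] Σ[ R ∈ (Fin m → Equation L (Fin n)) ] (∀ u v → CgFin L (F L V (Fin n)) R u v ⇔ Q u v)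
      retarget P⇔Q (m , R , R⇔P) = m , R , λ u v → ⇔.trans (R⇔P u v) (P⇔Q u v)

    cond3⇔kernelsFG : Cond3 L V k ⇔ AllKernelsFinitelyGenerated
    cond3⇔kernelsFG = mk⇔ (λ c3 n ts → Π-generates ts (c3 n ts)) (λ fg n ts → Π-axiomatizes ts (fg n ts))
      where
      open SetoidReasoning (⇔.⇔-setoid (lsuc lzero))

      ConsequencesFinitelyAxiomatized : ∀ {n} → (Fin n → Term L (Fin k)) → Set₁
      ConsequencesFinitelyAxiomatized {n} ts = Σ[ m ∈ ℕ ] Σ[ Π ∈ (Fin m → Equation L (Fin n)) ]
        (∀ ε → Consequence L V (yt L ts) (embY L (proj₁ ε) , embY L (proj₂ ε)) ⇔ Consequence L V Π ε)

      Π-generates : ∀ {n} (ts : Fin n → Term L (Fin k)) → ConsequencesFinitelyAxiomatized ts → KernelFinitelyGenerated ts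
      Π-generates ts (m , Π , yt⊨⇔Π⊨) = m , Π , λ u v → begin
        CgFin L (F L V _) Π u v                           ≈⟨ ⊨⇔Cg Π ⟨
        Consequence L V Π (u , v)                         ≈⟨ yt⊨⇔Π⊨ (u , v) ⟨
        Consequence L V (yt L ts) (embY L u , embY L v)   ≈⟨ ⊨-yt⇔≈ⱽ-subst ts u v ⟩
        subst ts u ≈ⱽ subst ts v                          ∎

      Π-axiomatizes : ∀ {n} (ts : Fin n → Term L (Fin k)) → KernelFinitelyGenerated ts → ConsequencesFinitelyAxiomatized ts
      Π-axiomatizes ts (m , Π , Π⇔kernel) = m , Π , λ (u , v) → begin
        Consequence L V (yt L ts) (embY L u , embY L v)   ≈⟨ ⊨-yt⇔≈ⱽ-subst ts u v ⟩
        subst ts u ≈ⱽ subst ts v                          ≈⟨ Π⇔kernel u v ⟨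
        CgFin L (F L V _) Π u v                           ≈⟨ ⊨⇔Cg Π ⟨
        Consequence L V Π (u , v)                         ∎

mainTheorem5 : (L : Language) (V : Variety L) (k : ℕ) →
    StandingAssumption L k →
    (Cond1 L V k ⇔ Cond2 L V k) × (Cond2 L V k ⇔ Cond3 L V k)
mainTheorem5 L V k _ =
  ⇔.trans (cond1⇔kernelsFG V k) (⇔.sym (cond2⇔kernelsFG V k)) ,
  ⇔.trans (cond2⇔kernelsFG V k) (⇔.sym (cond3⇔kernelsFG V k))
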